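{- For all integers $m\ge 2$ and $n\ge 1$, $\nu(m,\ldots,m)\le\min\bigl(m^2,\,n(m-2)+2\bigr)$, where $m$ is repeated $n$ times.
   Context: An $n$-uniform hypergraph is $n$-partite if its vertex set is the disjoint union of $n$ sets $V_1,\ldots,V_n$ and each edge meets each $V_i$ in exactly one vertex; it is written $(V_1,\ldots,V_n,E)$. An octahedral system is such a hypergraph with $|V_i|\ge 2$ for all $i$ satisfying the parity condition: for every $X\subseteq\bigcup_i V_i$ with $|X\cap V_i|=2$ for all $i$, the number of edges contained in $X$ is even. It is an $(m_1,\ldots,m_n)$-octahedral system if $|V_i|=m_i$ for all $i$. A vertex is isolated if it belongs to no edge. $\nu(m_1,\ldots,m_n)$ is the minimum number of edges over all $(m_1,\ldots,m_n)$-octahedral systems without isolated vertex. -}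

module Defs where

open import Data.Nat using (ℕ; zero; suc; _≤_; _*_; _+_; _∸_; _⊓_)
open import Data.Nat.Divisibility using (_∣_)
open import Data.Fin using (Fin; zero; suc)
open import Data.List using (List; []; _∷_; concatMap; map; length; filter; allFin)
open import Data.Bool using (Bool; true; false; if_then_else_; T)
open import Data.Product using (Σ; _×_; ∃)
open import Relation.Binary.PropositionalEquality using (_≡_; _≢_)

-- An n-partite hypergraph with parts V_i = Fin (m i) (i : Fin n).
-- A vertex is a pair (i , a) with a : Fin (m i).
-- Every possible edge meets each part in exactly one vertex, i.e. is a
-- transversal: a choice function picking one vertex in each part.
Transversal : (n : ℕ) → (Fin n → ℕ) → Set
Transversal n m = (i : Fin n) → Fin (m i)

EdgeSet : (n : ℕ) → (Fin n → ℕ) → Set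
EdgeSet n m = Transversal n m → Bool

consT : ∀ {n} {m : Fin (suc n) → ℕ} → Fin (m zero) →
        ((i : Fin n) → Fin (m (suc i))) → Transversal (suc n) m
consT a g zero    = a
consT a g (suc i) = g i

allTransversals : (n : ℕ) (m : Fin n → ℕ) → List (Transversal n m)
allTransversals zero    m = (λ ()) ∷ []
allTransversals (suc n) m =
  concatMap (λ a → map (consT a) (allTransversals n (λ i → m (suc i))))
            (allFin (m zero))

numEdges : ∀ {n m} → EdgeSet n m → ℕ
numEdges {n} {m} E = length (filter (λ t → T? (E t)) (allTransversals n m))
  where
  open import Relation.Nullary using (Dec; yes; no)
  open import Relation.Nullary.Decidable using () renaming (T? to T?′)
  T? : (b : Bool) → Dec (T b)
  T? = T?′

-- A set X with |X ∩ V_i| = 2 for all i is given by two distinct vertices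
-- x i ≢ y i in each part.  The edges contained in X are exactly the
-- transversals t with t i ∈ {x i , y i} for all i; these correspond
-- bijectively to selectors b : Fin n → Bool via (if b i then x i else y i).
select : ∀ {n m} → Transversal n m → Transversal n m → (Fin n → Bool) → Transversal n m
select x y b i = if b i then x i else y i

edgesIn : ∀ {n m} → EdgeSet n m → Transversal n m → Transversal n m → ℕ
edgesIn {n} E x y =
  numEdges {n} {λ _ → 2} (λ b → E (select x y (λ i → b i ≡ᵇ zero)))
  where
  open import Data.Fin using () renaming (_≟_ to _≟F_)
  open import Relation.Nullary.Decidable using (⌊_⌋)
  _≡ᵇ_ : Fin 2 → Fin 2 → Bool
  a ≡ᵇ c = ⌊ a ≟F c ⌋

IsOctahedral : ∀ {n m} → EdgeSet n m → Set
IsOctahedral {n} {m} E =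
  ((i : Fin n) → 2 ≤ m i) ×
  ((x y : Transversal n m) → ((i : Fin n) → x i ≢ y i) → 2 ∣ edgesIn E x y)

NoIsolatedVertex : ∀ {n m} → EdgeSet n m → Set
NoIsolatedVertex {n} {m} E =
  (i : Fin n) (a : Fin (m i)) → Σ (Transversal n m) λ t → (E t ≡ true) × (t i ≡ a)

-- ν(m_1,…,m_n) ≤ k  iff  some (m_1,…,m_n)-octahedral system without
-- isolated vertex has at most k edges (ν is the minimum of such counts)
ν≤ : (n : ℕ) → (Fin n → ℕ) → ℕ → Set
ν≤ n m k = Σ (EdgeSet n m) λ E → IsOctahedral E × NoIsolatedVertex E × (numEdges E ≤ k)

module Submission where

-- Both bounds come from explicit octahedral systems without isolated vertex
-- on n+1 parts of size m (vertices of a part are Fin m, written 0,1,2,…).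
-- Every system is built slice by slice: 'byFirst F' has the edge a·g
-- exactly when g is an edge of the slice F a.  Two counting facts drive
-- everything:
--   * |byFirst F| = ∑ₐ |F a|, and
--   * for X given by vertex pairs x,y, the number of edges of byFirst F
--     inside X is e(F (x 0)) + e(F (y 0)) on the remaining parts.
-- Hence byFirst F is octahedral as soon as any two distinct slices have
-- the same parity pattern ('SameParity').
--   * Square system (m² edges): first vertex free, the others all equal.
--     All slices coincide, so the parity condition is immediate.
--   * Linear system ((n+1)(m−2)+2 edges): slice 0 is Rₙ, all other slices
--     are Tₙ = {1ⁿ}, where Rₙ = {0ⁿ} ∪ {0ʲ a 1ⁿ⁻ʲ⁻¹ : a ≥ 2}.  It needs
--     SameParity Rₙ Tₙ, proved by induction: R₍ₙ₊₁₎ and T₍ₙ₊₁₎ split the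
--     linear system on n+1 parts, which is octahedral by the hypothesis.

open import Defs
open import Data.Nat using (ℕ; zero; suc; _≤_; _*_; _+_; _∸_; _⊓_; z≤n; s≤s)
open import Data.Nat.Properties
  using (+-comm; +-identityʳ; *-identityʳ; *-zeroʳ; *-comm; *-monoʳ-≤; ≤-reflexive; ≤-trans;
         ≤-total; m≤n⇒m⊓n≡m; m≥n⇒m⊓n≡n; +-0-monoid; +-commutativeSemigroup)
open import Data.Nat.Divisibility using (_∣_; divides)
open import Data.Nat.Tactic.RingSolver using (solve-∀)
open import Data.Fin using (Fin; zero; suc)
open import Data.List using (List; []; _∷_; _++_; map; length; filter; concatMap; tabulate)
open import Data.List.Properties using (filter-++; length-++)
open import Data.Bool using (Bool; true; false)
open import Data.Product using (Σ; _×_; _,_)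
open import Data.Sum using (inj₁; inj₂)
open import Data.Empty using (⊥-elim)
open import Relation.Nullary.Decidable using (T?)
open import Relation.Binary.PropositionalEquality
  using (_≡_; _≢_; refl; sym; trans; cong; cong₂; subst; module ≡-Reasoning)
open import Algebra.Properties.Monoid.Sum +-0-monoid using (sum-syntax; sum-cong-≗)
open import Algebra.Properties.CommutativeSemigroup +-commutativeSemigroup using (interchange)

open ≡-Reasoning

count : {A : Set} → (A → Bool) → List A → ℕ
count p xs = length (filter (λ x → T? (p x)) xs)

count-++ : {A : Set} (p : A → Bool) (xs ys : List A) →
           count p (xs ++ ys) ≡ count p xs + count p ys
count-++ p xs ys = trans (cong length (filter-++ (λ x → T? (p x)) xs ys))
                         (length-++ (filter (λ x → T? (p x)) xs))

count-map : {A B : Set} (p : B → Bool) (f : A → B) (xs : List A) →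
            count p (map f xs) ≡ count (λ x → p (f x)) xs
count-map p f []       = refl
count-map p f (x ∷ xs) with p (f x)
... | true  = cong suc (count-map p f xs)
... | false = count-map p f xs

count-concatMap : {A B : Set} (p : B → Bool) (f : A → List B) (M : ℕ) (h : Fin M → A) →
                  count p (concatMap f (tabulate h)) ≡ ∑[ a < M ] count p (f (h a))
count-concatMap p f zero    h = refl
count-concatMap p f (suc M) h =
  trans (count-++ p (f (h zero)) _) (cong (count p (f (h zero)) +_) (count-concatMap p f M (λ a → h (suc a))))

count-false : {A : Set} (xs : List A) → count (λ _ → false) xs ≡ 0
count-false []       = refl
count-false (x ∷ xs) = count-false xs

∑-const : (M c : ℕ) → ∑[ a < M ] c ≡ M * c
∑-const zero    c = refl
∑-const (suc M) c = cong (c +_) (∑-const M c)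

2∣n+n : (n : ℕ) → 2 ∣ n + n
2∣n+n n = divides n (trans (cong (n +_) (sym (+-identityʳ n))) (*-comm 2 n))

noEdge : ∀ {n m} → EdgeSet n m
noEdge _ = false

numEdges-noEdge : ∀ {n m} → numEdges {n} {m} noEdge ≡ 0
numEdges-noEdge {n} {m} = count-false (allTransversals n m)

edgesIn-noEdge : ∀ {n m} (x y : Transversal n m) → edgesIn noEdge x y ≡ 0
edgesIn-noEdge {n} x y = numEdges-noEdge {n} {λ _ → 2}

numEdges-slice : ∀ {n} {m : Fin (suc n) → ℕ} (E : EdgeSet (suc n) m) →
                 numEdges E ≡ ∑[ a < m zero ] numEdges {n} {λ i → m (suc i)} (λ g → E (consT a g))
numEdges-slice {n} {m} E = begin
  numEdges E
    ≡⟨ count-concatMap E (λ a → map (consT a) rest) (m zero) (λ a → a) ⟩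
  ∑[ a < m zero ] count E (map (consT a) rest)
    ≡⟨ sum-cong-≗ (λ a → count-map E (consT a) rest) ⟩
  ∑[ a < m zero ] numEdges (λ g → E (consT a g)) ∎
  where rest = allTransversals n (λ i → m (suc i))

UTransversal UEdgeSet : ℕ → ℕ → Set
UTransversal n M = Transversal n (λ _ → M)
UEdgeSet     n M = EdgeSet n (λ _ → M)

tail : ∀ {n M} → UTransversal (suc n) M → UTransversal n M
tail t i = t (suc i)

byFirst : ∀ {n M} → (Fin M → UEdgeSet n M) → UEdgeSet (suc n) M
byFirst F t = F (t zero) (tail t)

numEdges-byFirst : ∀ {n M} (F : Fin M → UEdgeSet n M) →
                   numEdges (byFirst F) ≡ ∑[ a < M ] numEdges (F a)
numEdges-byFirst F = numEdges-slice (byFirst F)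

edgesIn-byFirst : ∀ {n M} (F : Fin M → UEdgeSet n M) (x y : UTransversal (suc n) M) →
                  edgesIn (byFirst F) x y
                    ≡ edgesIn (F (x zero)) (tail x) (tail y) + edgesIn (F (y zero)) (tail x) (tail y)
edgesIn-byFirst {n} F x y =
  trans (numEdges-slice {n} {λ _ → 2} _)
        (cong (edgesIn (F (x zero)) (tail x) (tail y) +_) (+-identityʳ _))

Distinct : ∀ {n m} → Transversal n m → Transversal n m → Set
Distinct {n} x y = (i : Fin n) → x i ≢ y i

ParityCondition : ∀ {n m} → EdgeSet n m → Set
ParityCondition E = ∀ x y → Distinct x y → 2 ∣ edgesIn E x y

SameParity : ∀ {n m} → EdgeSet n m → EdgeSet n m → Set
SameParity F G = ∀ x y → Distinct x y → 2 ∣ edgesIn F x y + edgesIn G x y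

SameParity-refl : ∀ {n m} (F : EdgeSet n m) → SameParity F F
SameParity-refl F x y _ = 2∣n+n (edgesIn F x y)

SameParity-sym : ∀ {n m} (F G : EdgeSet n m) → SameParity F G → SameParity G F
SameParity-sym F G FG x y d = subst (2 ∣_) (+-comm (edgesIn F x y) (edgesIn G x y)) (FG x y d)

byFirst-parity : ∀ {n M} (F : Fin M → UEdgeSet n M) →
                 (∀ a b → a ≢ b → SameParity (F a) (F b)) → ParityCondition (byFirst F)
byFirst-parity F same x y d =
  subst (2 ∣_) (sym (edgesIn-byFirst F x y))
        (same (x zero) (y zero) (d zero) (tail x) (tail y) (λ i → d (suc i)))

onlyAt : ∀ {K n M} → Fin K → UEdgeSet n M → Fin K → UEdgeSet n M
onlyAt zero    F zero    = F
onlyAt zero    F (suc b) = noEdge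
onlyAt (suc a) F zero    = noEdge
onlyAt (suc a) F (suc b) = onlyAt a F b

onlyAt-self : ∀ {K n M} (a : Fin K) (F : UEdgeSet n M) → onlyAt a F a ≡ F
onlyAt-self zero    F = refl
onlyAt-self (suc a) F = onlyAt-self a F

∑-onlyAt : ∀ {K n M} (a : Fin K) (F : UEdgeSet n M) → ∑[ b < K ] numEdges (onlyAt a F b) ≡ numEdges F
∑-onlyAt {suc K} {n} {M} zero F = begin
  numEdges F + ∑[ b < K ] numEdges {n} {λ _ → M} noEdge
    ≡⟨ cong (numEdges F +_) (trans (∑-const K _) (cong (K *_) (numEdges-noEdge {n} {λ _ → M}))) ⟩
  numEdges F + K * 0
    ≡⟨ cong (numEdges F +_) (*-zeroʳ K) ⟩
  numEdges F + 0
    ≡⟨ +-identityʳ _ ⟩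
  numEdges F ∎
∑-onlyAt {suc K} {n} {M} (suc a) F =
  trans (cong (_+ ∑[ b < K ] numEdges (onlyAt a F b)) (numEdges-noEdge {n} {λ _ → M})) (∑-onlyAt a F)

Single : ∀ {n M} → UTransversal n M → UEdgeSet n M
Single {zero}  c _ = true
Single {suc n} c   = byFirst (onlyAt (c zero) (Single (tail c)))

numEdges-Single : ∀ {n M} (c : UTransversal n M) → numEdges (Single c) ≡ 1
numEdges-Single {zero}  c = refl
numEdges-Single {suc n} c =
  trans (numEdges-byFirst (onlyAt (c zero) (Single (tail c))))
        (trans (∑-onlyAt (c zero) (Single (tail c))) (numEdges-Single (tail c)))

Single-self : ∀ {n M} (c : UTransversal n M) → Single c c ≡ true
Single-self {zero}  c = refl
Single-self {suc n} c =
  trans (cong (λ F → F (tail c)) (onlyAt-self (c zero) (Single (tail c)))) (Single-self (tail c))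

diagonal : ∀ {M} n → UEdgeSet n M
diagonal zero    = λ _ → true
diagonal (suc n) = byFirst (λ b → Single (λ _ → b))

diagonal-const : ∀ {M} n (a : Fin M) → diagonal n (λ _ → a) ≡ true
diagonal-const zero    a = refl
diagonal-const (suc n) a = Single-self {n} (λ _ → a)

numEdges-diagonal : ∀ {M} n → 1 ≤ M → numEdges (diagonal {M} n) ≤ M
numEdges-diagonal     zero    1≤M = 1≤M
numEdges-diagonal {M} (suc n) _   = ≤-reflexive (begin
  numEdges (diagonal {M} (suc n))
    ≡⟨ numEdges-byFirst {n} {M} (λ b → Single (λ _ → b)) ⟩
  ∑[ b < M ] numEdges (Single {n} (λ _ → b))
    ≡⟨ sum-cong-≗ {M} (λ b → numEdges-Single {n} (λ _ → b)) ⟩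
  ∑[ b < M ] 1
    ≡⟨ trans (∑-const M 1) (*-identityʳ M) ⟩
  M ∎)

squareSystem : ∀ {M} n → UEdgeSet (suc n) M
squareSystem n = byFirst (λ _ → diagonal n)

square-bound : ∀ {M} n → 2 ≤ M → ν≤ (suc n) (λ _ → M) (M * M)
square-bound {M} n 2≤M =
  squareSystem n ,
  ((λ _ → 2≤M) , byFirst-parity (λ _ → diagonal n) (λ _ _ _ → SameParity-refl (diagonal n))) ,
  (λ _ a → (λ _ → a) , diagonal-const n a , refl) ,
  ≤-trans (≤-reflexive (trans (numEdges-byFirst (λ _ → diagonal {M} n)) (∑-const M _)))
          (*-monoʳ-≤ M (numEdges-diagonal n (≤-trans (s≤s z≤n) 2≤M)))

module Linear (k : ℕ) where

  M : ℕ
  M = suc (suc k)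

  one : Fin M
  one = suc zero

  zeros ones : ∀ {n} → UTransversal n M
  zeros _ = zero
  ones  _ = one

  T : ∀ n → UEdgeSet n M
  T n = Single ones

  numEdges-T : ∀ n → numEdges (T n) ≡ 1
  numEdges-T n = numEdges-Single {n} ones

  T-ones : ∀ n → T n ones ≡ true
  T-ones n = Single-self {n} ones

  -- Rₙ = {0ⁿ} ∪ {0ʲ a 1ⁿ⁻ʲ⁻¹ : a ≥ 2}, built from its slices
  R : ∀ n → UEdgeSet n M
  rSlice : ∀ n → Fin M → UEdgeSet n M
  R zero    = λ _ → true
  R (suc n) = byFirst (rSlice n)
  rSlice n zero          = R n
  rSlice n (suc zero)    = noEdge
  rSlice n (suc (suc _)) = T n

  sSlice : ∀ n → Fin M → UEdgeSet n M
  sSlice n zero    = R n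
  sSlice n (suc _) = T n

  linearSystem : ∀ n → UEdgeSet (suc n) M
  linearSystem n = byFirst (sSlice n)

  ∑-numEdges-T : ∀ n → ∑[ a < k ] numEdges (T n) ≡ k
  ∑-numEdges-T n = trans (∑-const k _) (trans (cong (k *_) (numEdges-T n)) (*-identityʳ k))

  numEdges-R : ∀ n → numEdges (R n) ≡ 1 + n * k
  numEdges-R zero    = refl
  numEdges-R (suc n) = begin
    numEdges (R (suc n))
      ≡⟨ numEdges-byFirst (rSlice n) ⟩
    numEdges (R n) + (numEdges {n} noEdge + ∑[ a < k ] numEdges (T n))
      ≡⟨ cong₂ (λ r z → r + (z + ∑[ a < k ] numEdges (T n))) (numEdges-R n) (numEdges-noEdge {n} {λ _ → M}) ⟩
    1 + n * k + ∑[ a < k ] numEdges (T n)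
      ≡⟨ cong (1 + n * k +_) (∑-numEdges-T n) ⟩
    1 + n * k + k
      ≡⟨ arithmetic n k ⟩
    1 + suc n * k ∎
    where
    arithmetic : ∀ n k → 1 + n * k + k ≡ 1 + suc n * k
    arithmetic = solve-∀

  numEdges-linear : ∀ n → numEdges (linearSystem n) ≡ suc n * k + 2
  numEdges-linear n = begin
    numEdges (linearSystem n)
      ≡⟨ numEdges-byFirst (sSlice n) ⟩
    numEdges (R n) + (numEdges (T n) + ∑[ a < k ] numEdges (T n))
      ≡⟨ cong₂ (λ r t → r + (t + ∑[ a < k ] numEdges (T n))) (numEdges-R n) (numEdges-T n) ⟩
    1 + n * k + (1 + ∑[ a < k ] numEdges (T n))
      ≡⟨ cong (λ s → 1 + n * k + (1 + s)) (∑-numEdges-T n) ⟩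
    1 + n * k + (1 + k)
      ≡⟨ arithmetic n k ⟩
    suc n * k + 2 ∎
    where
    arithmetic : ∀ n k → 1 + n * k + (1 + k) ≡ suc n * k + 2
    arithmetic = solve-∀

  linear-parity : ∀ n → SameParity (R n) (T n) → ParityCondition (linearSystem n)
  linear-parity n RT = byFirst-parity (sSlice n) same
    where
    same : ∀ a b → a ≢ b → SameParity (sSlice n a) (sSlice n b)
    same zero    zero    a≢b = ⊥-elim (a≢b refl)
    same zero    (suc _) _   = RT
    same (suc _) zero    _   = SameParity-sym (R n) (T n) RT
    same (suc _) (suc _) _   = SameParity-refl (T n)

  -- Slice by slice, R₍ₙ₊₁₎ and T₍ₙ₊₁₎ are disjoint with union the linear system.
  slices-add : ∀ n a (x y : UTransversal n M) →
               edgesIn (rSlice n a) x y + edgesIn (onlyAt one (T n) a) x y ≡ edgesIn (sSlice n a) x y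
  slices-add n zero          x y = trans (cong (edgesIn (R n) x y +_) (edgesIn-noEdge x y)) (+-identityʳ _)
  slices-add n (suc zero)    x y = cong (_+ edgesIn (T n) x y) (edgesIn-noEdge x y)
  slices-add n (suc (suc _)) x y = trans (cong (edgesIn (T n) x y +_) (edgesIn-noEdge x y)) (+-identityʳ _)

  R-T-split : ∀ n (x y : UTransversal (suc n) M) →
              edgesIn (R (suc n)) x y + edgesIn (T (suc n)) x y ≡ edgesIn (linearSystem n) x y
  R-T-split n x y = begin
    edgesIn (R (suc n)) x y + edgesIn (T (suc n)) x y
      ≡⟨ cong₂ _+_ (edgesIn-byFirst (rSlice n) x y) (edgesIn-byFirst (onlyAt one (T n)) x y) ⟩
    (r (x zero) + r (y zero)) + (t (x zero) + t (y zero))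
      ≡⟨ interchange (r (x zero)) (r (y zero)) (t (x zero)) (t (y zero)) ⟩
    (r (x zero) + t (x zero)) + (r (y zero) + t (y zero))
      ≡⟨ cong₂ _+_ (slices-add n (x zero) (tail x) (tail y)) (slices-add n (y zero) (tail x) (tail y)) ⟩
    edgesIn (sSlice n (x zero)) (tail x) (tail y) + edgesIn (sSlice n (y zero)) (tail x) (tail y)
      ≡⟨ sym (edgesIn-byFirst (sSlice n) x y) ⟩
    edgesIn (linearSystem n) x y ∎
    where
    r t : Fin M → ℕ
    r a = edgesIn (rSlice n a) (tail x) (tail y)
    t a = edgesIn (onlyAt one (T n) a) (tail x) (tail y)

  -- The key invariant, by induction on n (for n = 0 both sets are {()}).
  R-T-sameParity : ∀ n → SameParity (R n) (T n)
  R-T-sameParity zero    x y _ = divides 1 refl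
  R-T-sameParity (suc n) x y d =
    subst (2 ∣_) (sym (R-T-split n x y)) (linear-parity n (R-T-sameParity n) x y d)

  R-zeros : ∀ n → R n zeros ≡ true
  R-zeros zero    = refl
  R-zeros (suc n) = R-zeros n

  R-covers : ∀ n (j : Fin n) (a : Fin M) → a ≢ one →
             Σ (UTransversal n M) λ g → (R n g ≡ true) × (g j ≡ a)
  R-covers (suc n) zero    zero          _   = zeros , R-zeros (suc n) , refl
  R-covers (suc n) zero    (suc zero)    a≢1 = ⊥-elim (a≢1 refl)
  R-covers (suc n) zero    (suc (suc b)) _   = consT (suc (suc b)) ones , T-ones n , refl
  R-covers (suc n) (suc j) a             a≢1 with R-covers n j a a≢1
  ... | g , g∈R , gj≡a = consT zero g , g∈R , gj≡a

  linear-noIsolated : ∀ n → NoIsolatedVertex (linearSystem n)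
  linear-noIsolated n zero    zero          = zeros , R-zeros n , refl
  linear-noIsolated n zero    (suc b)       = consT (suc b) ones , T-ones n , refl
  linear-noIsolated n (suc j) (suc zero)    = ones , T-ones n , refl
  linear-noIsolated n (suc j) zero with R-covers n j zero (λ ())
  ... | g , g∈R , gj≡a = consT zero g , g∈R , gj≡a
  linear-noIsolated n (suc j) (suc (suc b)) with R-covers n j (suc (suc b)) (λ ())
  ... | g , g∈R , gj≡a = consT zero g , g∈R , gj≡a

  linear-bound : ∀ n → ν≤ (suc n) (λ _ → M) (suc n * k + 2)
  linear-bound n =
    linearSystem n ,
    ((λ _ → s≤s (s≤s z≤n)) , linear-parity n (R-T-sameParity n)) ,
    linear-noIsolated n ,
    ≤-reflexive (numEdges-linear n)

ν≤-⊓ : ∀ {n m a b} → ν≤ n m a → ν≤ n m b → ν≤ n m (a ⊓ b)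
ν≤-⊓ {a = a} {b} (E , oct , iso , E≤a) (E′ , oct′ , iso′ , E′≤b) with ≤-total a b
... | inj₁ a≤b = E  , oct  , iso  , subst (numEdges E ≤_) (sym (m≤n⇒m⊓n≡m a≤b)) E≤a
... | inj₂ b≤a = E′ , oct′ , iso′ , subst (numEdges E′ ≤_) (sym (m≥n⇒m⊓n≡n b≤a)) E′≤b

proposition2p6 : (m n : ℕ) → 2 ≤ m → 1 ≤ n →
    ν≤ n (λ _ → m) ((m * m) ⊓ (n * (m ∸ 2) + 2))
proposition2p6 (suc (suc k)) (suc n) 2≤m@(s≤s (s≤s _)) (s≤s _) =
  ν≤-⊓ (square-bound n 2≤m) (Linear.linear-bound k n)
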